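{- For every $n$, there exists a permutation $\pi$ of $[n]=\{1,\dots,n\}$ such that inserting the keys $\pi(1),\pi(2),\dots,\pi(n)$ (in this order, with arbitrary values) into an initially empty \textsc{Lua} hybrid table requires $\Omega(n\log n)$ calls to the insertion function; that is, in the worst case over permutations of $[n]$, $\Omega(n\log n)$ calls are needed.
   Context: \textbf{\textsc{Lua} hybrid table.} A table has an array-part, whose range of keys is $[1,2^a]$ for some $a\ge 0$ (or empty initially), and a hash-part, which is a \textsc{Lua} hashmap of size a power of two. When a key/value pair is inserted: if the key is a positive integer inside the current range of the array-part, the value is stored there. Otherwise the pair is inserted into the hash-part: placed at its hashed slot if that slot is free, otherwise into a free slot found by a downward scan with a pointer that only decreases; if no free slot exists, a rehash is triggered. At a rehash, one computes the largest $a'\ge0$ such that $[1,2^{a'}]$ contains at least $2^{a'-1}+1$ keys of the table; the new array-part has range $[1,2^{a'}]$ and receives the values of the keys in that range; all other keys are reinserted (via the insertion function) into a new hash-part of size $2^{m}$, where $m$ is chosen so that the number of elements it contains lies in $(2^{m-1},2^m]$. The number of calls to the insertion function counts one call per insertion plus one call per key reinserted into the hash-part during rehashes. -}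

module Defs where

open import Data.Nat.Base using (ℕ; zero; suc; _+_; _^_; _≤ᵇ_; _<ᵇ_; ⌊_/2⌋)
open import Data.Nat.Logarithm using (⌈log₂_⌉)
open import Data.Bool.Base using (Bool; true; false; if_then_else_; _∧_; not)
open import Data.Maybe.Base using (Maybe; just; nothing)
open import Data.List.Base using (List; []; _∷_; _++_; [_]; length; filter; catMaybes; replicate; foldl)
open import Data.Fin.Base using (Fin; toℕ)
open import Data.Product.Base using (_×_; _,_; proj₂)
open import Relation.Nullary.Decidable.Core using (T?)

-- A model of the Lua hybrid table (only keys matter; values are
-- arbitrary and irrelevant for the number of insertion calls).

-- A hash function: for a key k and a hash part of size 2^m it gives the
-- hashed slot of k, an index in [0, 2^m).  The statement quantifies over
-- all such functions (the context does not fix one).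
Hash : Set
Hash = (k : ℕ) (m : ℕ) → Fin (2 ^ m)

-- Slots of a hash part: nothing = free, just k = occupied by key k.
Slots : Set
Slots = List (Maybe ℕ)

isFree : Slots → ℕ → Bool
isFree []             _       = false
isFree (nothing ∷ _)  zero    = true
isFree (just _ ∷ _)   zero    = false
isFree (_ ∷ xs)       (suc i) = isFree xs i

setSlot : Slots → ℕ → ℕ → Slots
setSlot []       _       _ = []
setSlot (_ ∷ xs) zero    k = just k ∷ xs
setSlot (x ∷ xs) (suc i) k = x ∷ setSlot xs i k

findFree : Slots → ℕ → Maybe ℕ
findFree sl zero    = nothing
findFree sl (suc p) = if isFree sl p then just p else findFree sl p

record HashPart : Set where
  constructor mkHash
  field
    exp   : ℕ
    slots : Slots
    ptr   : ℕ
open HashPart public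

freshHash : ℕ → HashPart
freshHash m = mkHash m (replicate (2 ^ m) nothing) (2 ^ m)

hashKeys : HashPart → List ℕ
hashKeys H = catMaybes (slots H)

hashInsert : Hash → HashPart → ℕ → Maybe HashPart
hashInsert h (mkHash m sl p) k with toℕ (h k m)
... | s = if isFree sl s
           then just (mkHash m (setSlot sl s k) p)
           else go (findFree sl p)
  where
  go : Maybe ℕ → Maybe HashPart
  go nothing   = nothing
  go (just p′) = just (mkHash m (setSlot sl p′ k) p′)

-- The hash part is either empty (size 0, initially) or a HashPart.
hashKeys? : Maybe HashPart → List ℕ
hashKeys? nothing  = []
hashKeys? (just H) = hashKeys H

record Table : Set where
  constructor mkTable
  field
    arrExp  : Maybe ℕ      -- nothing: empty array part; just a: range [1,2^a]
    arrKeys : List ℕ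
    hpart   : Maybe HashPart
open Table public

emptyTable : Table
emptyTable = mkTable nothing [] nothing

inRange : ℕ → ℕ → Bool
inRange a k = (1 ≤ᵇ k) ∧ (k ≤ᵇ 2 ^ a)

inArr : Maybe ℕ → ℕ → Bool
inArr nothing  _ = false
inArr (just a) k = inRange a k

cnt : ℕ → List ℕ → ℕ
cnt a K = length (filter (λ x → T? (inRange a x)) K)

-- [1,2^a] contains at least ⌊2^(a-1)⌋+1 keys of K (2^(a-1) read as ⌊2^a/2⌋)
dense : ℕ → List ℕ → Bool
dense a K = ⌊ 2 ^ a /2⌋ <ᵇ cnt a K

largestDense : ℕ → List ℕ → Maybe ℕ
largestDense zero    K = if dense zero K then just zero else nothing
largestDense (suc a) K = if dense (suc a) K then just (suc a) else largestDense a K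

-- largest a ≥ 0 with dense a K; dense a K forces a < length K, so the
-- bounded search is exhaustive.
newArrExp : List ℕ → Maybe ℕ
newArrExp K = largestDense (length K) K

-- reinsertion of keys into a fresh hash part (never overflows, since it
-- is sized to hold them; an impossible overflow would drop the key)
insertAll : Hash → HashPart → List ℕ → HashPart
insertAll h H []       = H
insertAll h H (k ∷ ks) with hashInsert h H k
... | just H′ = insertAll h H′ ks
... | nothing = insertAll h H ks

-- new hash part holding the keys H: size 0 if H is empty, otherwise of
-- size 2^m with |H| ∈ (2^(m-1), 2^m], i.e. m = ⌈log₂ |H|⌉.
buildHash : Hash → List ℕ → Maybe HashPart
buildHash h []      = nothing
buildHash h (k ∷ H) = just (insertAll h (freshHash ⌈log₂ length (k ∷ H) ⌉) (k ∷ H))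

-- Rehash triggered while inserting the pending key k.  Returns the new
-- table and the number of (old) keys reinserted into the new hash part.
rehash : Hash → Table → ℕ → Table × ℕ
rehash h t k =
  mkTable a′ (filter (λ x → T? (inArr a′ x)) K) (buildHash h (filter (λ x → T? (not (inArr a′ x))) K))
  , length (filter (λ x → T? (not (inArr a′ x))) old)
  where
  old = arrKeys t ++ hashKeys? (hpart t)
  K   = old ++ [ k ]
  a′  = newArrExp K

-- one insertion: returns the new table and the number of calls to the
-- insertion function it costs (1 + number of keys reinserted into the
-- hash part by a rehash, if one occurs).
insertKey : Hash → Table → ℕ → Table × ℕ
insertKey h t k with inArr (arrExp t) k | hpart t
... | true  | _        = mkTable (arrExp t) (k ∷ arrKeys t) (hpart t) , 1
... | false | nothing  = rehashCost
  where
  rehashCost : Table × ℕ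
  rehashCost with rehash h t k
  ... | t′ , r = t′ , suc r
... | false | just H with hashInsert h H k
...   | just H′ = mkTable (arrExp t) (arrKeys t) (just H′) , 1
...   | nothing = rehashCost
  where
  rehashCost : Table × ℕ
  rehashCost with rehash h t k
  ... | t′ , r = t′ , suc r

step : Hash → Table × ℕ → ℕ → Table × ℕ
step h (t , c) k with insertKey h t k
... | t′ , d = t′ , c + d

luaCalls : Hash → List ℕ → ℕ
luaCalls h ks = proj₂ (foldl (step h) (emptyTable , 0) ks)

-- Insert first 2^j keys larger than all the others, then the keys 1, 2, 3, … in increasing order.
-- The big keys are never dense enough to enter the array part, so they end up filling a hash part
-- of size exactly 2^j.  From then on, for each A ≤ j the key 2^A + 1 lies just outside the array
-- part [1,2^A] while the hash part is full: it triggers a rehash that moves the array part to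
-- [1,2^(A+1)] and reinserts all 2^j big keys into a new, again full, hash part of size 2^j.
-- These j + 1 rehashes cost (j + 1)(2^j + 1) calls, which is Ω(n log n) for 2^j ≈ n/8.
module Submission where

open import Defs
open import Data.Bool.Base using (Bool; true; false; T; not)
open import Data.Bool.Properties using (T-≡)
open import Data.Empty using (⊥; ⊥-elim)
open import Data.Fin.Base using (toℕ)
open import Data.List.Base
open import Data.List.Properties
  using ( length-replicate; length-++; length-catMaybes; length-filter; length-++-comm; length-++-≤ˡ; length-++-≤ʳ
        ; filter-++; filter-all; filter-none; ++-identityʳ )
open import Data.List.Relation.Binary.Permutation.Propositional using (_↭_; ↭-trans; ↭-reflexive)
open import Data.List.Relation.Binary.Permutation.Propositional.Properties using (++-comm)
open import Data.List.Relation.Unary.All using (All; []; _∷_)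
import Data.List.Relation.Unary.All as All
open import Data.List.Relation.Unary.All.Properties using (++⁺)
open import Data.Maybe.Base using (Maybe; just; nothing)
open import Data.Nat.Base
open import Data.Nat.Logarithm
  using (⌊log₂_⌋; ⌈log₂_⌉; ⌊log₂⌋-mono-≤; ⌈log₂⌉-mono-≤; ⌊log₂[2^n]⌋≡n; ⌈log₂2^n⌉≡n)
open import Data.Nat.Logarithm.Core using (⌊log2⌋; ⌈log2⌉)
open import Data.Nat.Properties
open import Algebra.Properties.CommutativeSemigroup +-commutativeSemigroup using (xy∙z≈xz∙y)
open import Data.Nat.Tactic.RingSolver using (solve-∀)
open import Data.Product.Base using (∃-syntax; _×_; _,_; proj₁; proj₂)
open import Data.Sum.Base using (inj₁; inj₂; [_,_]′)
open import Function.Bundles using (Equivalence)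
import Induction.WellFounded as IWF
open import Relation.Binary.PropositionalEquality hiding ([_])
open import Relation.Nullary using (¬_; yes; no)
open import Relation.Nullary.Decidable.Core using (T?)

isFree-beyond : ∀ sl i → length sl ≤ i → isFree sl i ≡ false
isFree-beyond []             i       _           = refl
isFree-beyond (nothing ∷ sl) (suc i) (s≤s len≤i) = isFree-beyond sl i len≤i
isFree-beyond (just _ ∷ sl)  zero    _           = refl
isFree-beyond (just _ ∷ sl)  (suc i) (s≤s len≤i) = isFree-beyond sl i len≤i

isFree-setSlot-self : ∀ sl i k → isFree (setSlot sl i k) i ≡ false
isFree-setSlot-self []             i       k = refl
isFree-setSlot-self (x ∷ sl)       zero    k = refl
isFree-setSlot-self (nothing ∷ sl) (suc i) k = isFree-setSlot-self sl i k
isFree-setSlot-self (just _ ∷ sl)  (suc i) k = isFree-setSlot-self sl i k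

setSlot-preserves-occupied : ∀ sl i k j → isFree sl j ≡ false → isFree (setSlot sl i k) j ≡ false
setSlot-preserves-occupied []             i       k j       occ = occ
setSlot-preserves-occupied (x ∷ sl)       zero    k zero    occ = refl
setSlot-preserves-occupied (nothing ∷ sl) zero    k (suc j) occ = occ
setSlot-preserves-occupied (just _ ∷ sl)  zero    k (suc j) occ = occ
setSlot-preserves-occupied (nothing ∷ sl) (suc i) k zero    occ = occ
setSlot-preserves-occupied (just _ ∷ sl)  (suc i) k zero    occ = occ
setSlot-preserves-occupied (nothing ∷ sl) (suc i) k (suc j) occ = setSlot-preserves-occupied sl i k j occ
setSlot-preserves-occupied (just _ ∷ sl)  (suc i) k (suc j) occ = setSlot-preserves-occupied sl i k j occ

length-setSlot : ∀ sl i k → length (setSlot sl i k) ≡ length sl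
length-setSlot []       i       k = refl
length-setSlot (x ∷ sl) zero    k = refl
length-setSlot (x ∷ sl) (suc i) k = cong suc (length-setSlot sl i k)

length-catMaybes-setSlot : ∀ sl i k → isFree sl i ≡ true →
                           length (catMaybes (setSlot sl i k)) ≡ suc (length (catMaybes sl))
length-catMaybes-setSlot (nothing ∷ sl) zero    k _    = refl
length-catMaybes-setSlot (nothing ∷ sl) (suc i) k free = length-catMaybes-setSlot sl i k free
length-catMaybes-setSlot (just _ ∷ sl)  (suc i) k free = cong suc (length-catMaybes-setSlot sl i k free)

All-catMaybes-setSlot : ∀ {P : ℕ → Set} sl i k → All P (catMaybes sl) → P k →
                        All P (catMaybes (setSlot sl i k))
All-catMaybes-setSlot []             i       k ps       pk = ps
All-catMaybes-setSlot (nothing ∷ sl) zero    k ps       pk = pk ∷ ps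
All-catMaybes-setSlot (just _ ∷ sl)  zero    k (_ ∷ ps) pk = pk ∷ ps
All-catMaybes-setSlot (nothing ∷ sl) (suc i) k ps       pk = All-catMaybes-setSlot sl i k ps pk
All-catMaybes-setSlot (just _ ∷ sl)  (suc i) k (p ∷ ps) pk = p ∷ All-catMaybes-setSlot sl i k ps pk

length-catMaybes-< : ∀ sl i → isFree sl i ≡ true → length (catMaybes sl) < length sl
length-catMaybes-< (nothing ∷ sl) zero    _    = s≤s (length-catMaybes sl)
length-catMaybes-< (nothing ∷ sl) (suc i) free = m<n⇒m<1+n (length-catMaybes-< sl i free)
length-catMaybes-< (just _ ∷ sl)  (suc i) free = s≤s (length-catMaybes-< sl i free)

length-catMaybes-full : ∀ sl → (∀ i → isFree sl i ≡ false) → length (catMaybes sl) ≡ length sl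
length-catMaybes-full []             full = refl
length-catMaybes-full (nothing ∷ sl) full with full zero
... | ()
length-catMaybes-full (just _ ∷ sl)  full = cong suc (length-catMaybes-full sl (λ i → full (suc i)))

findFree-just : ∀ sl p q → findFree sl p ≡ just q →
                isFree sl q ≡ true × (∀ i → q < i → i < p → isFree sl i ≡ false)
findFree-just sl (suc p) q found with isFree sl p in free
findFree-just sl (suc p) q refl | true  = free , λ i q<i i<1+p → ⊥-elim (<-irrefl refl (≤-trans i<1+p q<i))
... | false with findFree-just sl p q found
... | free-q , skipped = free-q , λ i q<i i<1+p → [ skipped i q<i , (λ { refl → free }) ]′ (m<1+n⇒m<n∨m≡n i<1+p)

findFree-nothing : ∀ sl p → findFree sl p ≡ nothing → ∀ i → i < p → isFree sl i ≡ false
findFree-nothing sl (suc p) none i i<1+p with isFree sl p in free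
findFree-nothing sl (suc p) () i i<1+p | true
... | false with m<1+n⇒m<n∨m≡n i<1+p
... | inj₁ i<p  = findFree-nothing sl p none i i<p
... | inj₂ refl = free

record Stores (P : ℕ → Set) (n : ℕ) (H : HashPart) : Set where
  field
    size     : length (slots H) ≡ 2 ^ exp H
    -- the downward scan only looks below the pointer, so this is what makes it find every free slot
    occupied : ∀ i → ptr H ≤ i → isFree (slots H) i ≡ false
    count    : length (hashKeys H) ≡ n
    keys     : All P (hashKeys H)
open Stores

Stores-≤ : ∀ {P n} H → Stores P n H → n ≤ 2 ^ exp H
Stores-≤ {n = n} H st = begin
  n                       ≡⟨ count st ⟨
  length (hashKeys H)     ≤⟨ length-catMaybes (slots H) ⟩
  length (slots H)        ≡⟨ size st ⟩
  2 ^ exp H               ∎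
  where open ≤-Reasoning

catMaybes-replicate : ∀ n → catMaybes (replicate n (nothing {A = ℕ})) ≡ []
catMaybes-replicate zero    = refl
catMaybes-replicate (suc n) = catMaybes-replicate n

Stores-fresh : ∀ {P} m → Stores P 0 (freshHash m)
Stores-fresh m = record
  { size     = length-replicate (2 ^ m)
  ; occupied = λ i 2^m≤i → isFree-beyond (replicate (2 ^ m) nothing) i (≤-trans (≤-reflexive (length-replicate (2 ^ m))) 2^m≤i)
  ; count    = cong length (catMaybes-replicate (2 ^ m))
  ; keys     = subst (All _) (sym (catMaybes-replicate (2 ^ m))) []
  }

occupy : ∀ {P n m sl p p′ s} k → Stores P n (mkHash m sl p) → isFree sl s ≡ true →
         (∀ i → p′ ≤ i → i ≢ s → isFree sl i ≡ false) → P k →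
         Stores P (suc n) (mkHash m (setSlot sl s k) p′)
occupy {sl = sl} {p′ = p′} {s = s} k st free others pk = record
  { size     = trans (length-setSlot sl s k) (size st)
  ; occupied = occupied′
  ; count    = trans (length-catMaybes-setSlot sl s k free) (cong suc (count st))
  ; keys     = All-catMaybes-setSlot sl s k (keys st) pk
  }
  where
  occupied′ : ∀ i → p′ ≤ i → isFree (setSlot sl s k) i ≡ false
  occupied′ i p′≤i with i ≟ s
  ... | yes refl = isFree-setSlot-self sl s k
  ... | no  i≢s  = setSlot-preserves-occupied sl s k i (others i p′≤i i≢s)

hashInsert-full : ∀ {P} h H k → Stores P (2 ^ exp H) H → hashInsert h H k ≡ nothing
hashInsert-full h (mkHash m sl p) k st with isFree sl (toℕ (h k m)) in free
... | true  = ⊥-elim (no-free-slot free)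
  where
  no-free-slot : ∀ {i} → isFree sl i ≡ true → ⊥
  no-free-slot free = <-irrefl (trans (count st) (sym (size st))) (length-catMaybes-< sl _ free)
... | false with findFree sl p in found
...   | nothing = refl
...   | just q  = ⊥-elim (<-irrefl (trans (count st) (sym (size st)))
                                   (length-catMaybes-< sl q (proj₁ (findFree-just sl p q found))))

hashInsert-stores : ∀ {P n} h H k → Stores P n H → n < 2 ^ exp H → P k →
                    ∃[ H′ ] hashInsert h H k ≡ just H′ × exp H′ ≡ exp H × Stores P (suc n) H′
hashInsert-stores {n = n} h (mkHash m sl p) k st n<2^m pk with isFree sl (toℕ (h k m)) in free
... | true = _ , refl , refl , occupy k st free (λ i p≤i _ → occupied st i p≤i) pk
... | false with findFree sl p in found
...   | just q = _ , refl , refl , occupy k st free-q above-q pk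
  where
  free-q  = proj₁ (findFree-just sl p q found)
  above-q : ∀ i → q ≤ i → i ≢ q → isFree sl i ≡ false
  above-q i q≤i i≢q with i <? p
  ... | yes i<p = proj₂ (findFree-just sl p q found) i (≤∧≢⇒< q≤i (λ q≡i → i≢q (sym q≡i))) i<p
  ... | no  i≮p = occupied st i (≮⇒≥ i≮p)
...   | nothing = ⊥-elim (<-irrefl full n<2^m)
  where
  all-occupied : ∀ i → isFree sl i ≡ false
  all-occupied i with i <? p
  ... | yes i<p = findFree-nothing sl p found i i<p
  ... | no  i≮p = occupied st i (≮⇒≥ i≮p)
  full : n ≡ 2 ^ m
  full = trans (sym (count st)) (trans (length-catMaybes-full sl all-occupied) (size st))

insertAll-stores : ∀ {P n} h H ks → Stores P n H → n + length ks ≤ 2 ^ exp H → All P ks →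
                   exp (insertAll h H ks) ≡ exp H × Stores P (n + length ks) (insertAll h H ks)
insertAll-stores {n = n} h H []       st _    _          = refl , subst (λ c → Stores _ c H) (sym (+-identityʳ n)) st
insertAll-stores {P} {n} h H (k ∷ ks) st fits (pk ∷ pks)
  with fits′ ← ≤-trans (≤-reflexive (sym (+-suc n (length ks)))) fits
  with hashInsert-stores h H k st (m+n≤o⇒m≤o (suc n) fits′) pk
... | H′ , inserted , exp≡ , st′ rewrite inserted
  with insertAll-stores h H′ ks st′ (subst (λ e → suc n + length ks ≤ 2 ^ e) (sym exp≡) fits′) pks
... | exp≡′ , st″ = trans exp≡′ exp≡ , subst (λ c → Stores P c (insertAll h H′ ks)) (sym (+-suc n (length ks))) st″

n≤2^⌈log2⌉n : ∀ n acc → n ≤ 2 ^ ⌈log2⌉ n acc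
n≤2^⌈log2⌉n zero          _   = z≤n
n≤2^⌈log2⌉n (suc zero)    _   = s≤s z≤n
n≤2^⌈log2⌉n (suc (suc n)) (IWF.acc rs) = begin
  2 + n                            ≡⟨ cong (2 +_) (⌊n/2⌋+⌈n/2⌉≡n n) ⟨
  2 + (⌊ n /2⌋ + ⌈ n /2⌉)           ≤⟨ s≤s (s≤s (+-monoˡ-≤ ⌈ n /2⌉ (⌊n/2⌋≤⌈n/2⌉ n))) ⟩
  2 + (⌈ n /2⌉ + ⌈ n /2⌉)           ≡⟨ cong suc (+-suc ⌈ n /2⌉ ⌈ n /2⌉) ⟨
  suc ⌈ n /2⌉ + suc ⌈ n /2⌉         ≡⟨ cong (suc ⌈ n /2⌉ +_) (+-identityʳ (suc ⌈ n /2⌉)) ⟨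
  2 * suc ⌈ n /2⌉                  ≤⟨ *-monoʳ-≤ 2 (n≤2^⌈log2⌉n (suc ⌈ n /2⌉) _) ⟩
  2 * 2 ^ ⌈log2⌉ (suc ⌈ n /2⌉) _    ∎
  where open ≤-Reasoning

n≤2^⌈log₂n⌉ : ∀ n → n ≤ 2 ^ ⌈log₂ n ⌉
n≤2^⌈log₂n⌉ n = n≤2^⌈log2⌉n n _

buildHash-stores : ∀ {P} h ks → 0 < length ks → All P ks →
                   ∃[ H ] buildHash h ks ≡ just H × exp H ≡ ⌈log₂ length ks ⌉ × Stores P (length ks) H
buildHash-stores h ks@(_ ∷ _) _ pks =
  _ , refl , insertAll-stores h _ ks (Stores-fresh _) fits pks
  where
  fits : length ks ≤ 2 ^ ⌈log₂ length ks ⌉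
  fits = n≤2^⌈log₂n⌉ (length ks)

after : Hash → Table → List ℕ → Table
after h t []       = t
after h t (k ∷ ks) = after h (proj₁ (insertKey h t k)) ks

calls : Hash → Table → List ℕ → ℕ
calls h t []       = 0
calls h t (k ∷ ks) = proj₂ (insertKey h t k) + calls h (proj₁ (insertKey h t k)) ks

foldl-step : ∀ h t c ks → foldl (step h) (t , c) ks ≡ (after h t ks , c + calls h t ks)
foldl-step h t c []       = cong (t ,_) (sym (+-identityʳ c))
foldl-step h t c (k ∷ ks) with insertKey h t k
... | t′ , d = trans (foldl-step h t′ (c + d) ks) (cong (after h t′ ks ,_) (+-assoc c d (calls h t′ ks)))

luaCalls≡calls : ∀ h ks → luaCalls h ks ≡ calls h emptyTable ks
luaCalls≡calls h ks = cong proj₂ (foldl-step h emptyTable 0 ks)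

after-++ : ∀ h t xs ys → after h t (xs ++ ys) ≡ after h (after h t xs) ys
after-++ h t []       ys = refl
after-++ h t (x ∷ xs) ys = after-++ h _ xs ys

calls-++ : ∀ h t xs ys → calls h t (xs ++ ys) ≡ calls h t xs + calls h (after h t xs) ys
calls-++ h t []       ys = refl
calls-++ h t (x ∷ xs) ys = trans (cong (d +_) (calls-++ h t′ xs ys)) (sym (+-assoc d (calls h t′ xs) _))
  where
  t′ = proj₁ (insertKey h t x)
  d  = proj₂ (insertKey h t x)

insertKey-inArr : ∀ h ae ak hp k → inArr ae k ≡ true →
                  insertKey h (mkTable ae ak hp) k ≡ (mkTable ae (k ∷ ak) hp , 1)
insertKey-inArr h ae ak hp k inside rewrite inside = refl

insertKey-hashInsert : ∀ h ae ak H H′ k → inArr ae k ≡ false → hashInsert h H k ≡ just H′ →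
                       insertKey h (mkTable ae ak (just H)) k ≡ (mkTable ae ak (just H′) , 1)
insertKey-hashInsert h ae ak H H′ k outside inserted rewrite outside | inserted = refl

insertKey-rehash : ∀ h ae ak hp k → inArr ae k ≡ false → (∀ {H} → hp ≡ just H → hashInsert h H k ≡ nothing) →
                   let t = mkTable ae ak hp in
                   insertKey h t k ≡ (proj₁ (rehash h t k) , suc (proj₂ (rehash h t k)))
insertKey-rehash h ae ak nothing  k outside _ rewrite outside with rehash h (mkTable ae ak nothing) k
... | _ = refl
insertKey-rehash h ae ak (just H) k outside full rewrite outside | full refl
  with rehash h (mkTable ae ak (just H)) k
... | _ = refl

oldKeys : Table → List ℕ
oldKeys t = arrKeys t ++ hashKeys? (hpart t)

rehash-≡ : ∀ h t k {a′} → let K = oldKeys t ++ [ k ] in newArrExp K ≡ a′ →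
           rehash h t k ≡ ( mkTable a′ (filter (λ x → T? (inArr a′ x)) K)
                                       (buildHash h (filter (λ x → T? (not (inArr a′ x))) K))
                          , length (filter (λ x → T? (not (inArr a′ x))) (oldKeys t)) )
rehash-≡ h t k refl = refl

¬T⇒≡false : ∀ {b} → ¬ T b → b ≡ false
¬T⇒≡false {false} _ = refl
¬T⇒≡false {true}  p = ⊥-elim (p _)

¬T⇒T-not : ∀ {b} → ¬ T b → T (not b)
¬T⇒T-not {false} _ = _
¬T⇒T-not {true}  p = p _

T⇒¬T-not : ∀ {b} → T b → ¬ T (not b)
T⇒¬T-not {true} _ ()

module _ (f : ℕ → Bool) {xs ys : List ℕ} (inside : All (λ x → T (f x)) xs) (outside : All (λ y → ¬ T (f y)) ys) where

  filter-inside : filter (λ x → T? (f x)) (xs ++ ys) ≡ xs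
  filter-inside = begin
    filter (λ x → T? (f x)) (xs ++ ys)
      ≡⟨ filter-++ (λ x → T? (f x)) xs ys ⟩
    filter (λ x → T? (f x)) xs ++ filter (λ x → T? (f x)) ys
      ≡⟨ cong₂ _++_ (filter-all (λ x → T? (f x)) inside) (filter-none (λ x → T? (f x)) outside) ⟩
    xs ++ []
      ≡⟨ ++-identityʳ xs ⟩
    xs ∎
    where open ≡-Reasoning

  filter-outside : filter (λ x → T? (not (f x))) (xs ++ ys) ≡ ys
  filter-outside = begin
    filter (λ x → T? (not (f x))) (xs ++ ys)
      ≡⟨ filter-++ (λ x → T? (not (f x))) xs ys ⟩
    filter (λ x → T? (not (f x))) xs ++ filter (λ x → T? (not (f x))) ys
      ≡⟨ cong₂ _++_ (filter-none (λ x → T? (not (f x))) (All.map T⇒¬T-not inside))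
                    (filter-all (λ x → T? (not (f x))) (All.map ¬T⇒T-not outside)) ⟩
    ys ∎
    where open ≡-Reasoning

inRange-intro : ∀ a {x} → 1 ≤ x → x ≤ 2 ^ a → T (inRange a x)
inRange-intro a {suc x} _ x≤2^a = ≤⇒≤ᵇ x≤2^a

inRange-above : ∀ a {x} → 2 ^ a < x → ¬ T (inRange a x)
inRange-above a {suc x} 2^a<x inside = <⇒≱ 2^a<x (≤ᵇ⇒≤ (suc x) (2 ^ a) inside)

cnt-++ : ∀ a xs ys → cnt a (xs ++ ys) ≡ cnt a xs + cnt a ys
cnt-++ a xs ys = trans (cong length (filter-++ (λ x → T? (inRange a x)) xs ys))
                       (length-++ (filter (λ x → T? (inRange a x)) xs))

cnt-≤ : ∀ a xs → cnt a xs ≤ length xs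
cnt-≤ a = length-filter (λ x → T? (inRange a x))

cnt-all : ∀ a {xs} → All (λ x → T (inRange a x)) xs → cnt a xs ≡ length xs
cnt-all a inside = cong length (filter-all (λ x → T? (inRange a x)) inside)

cnt-above : ∀ a {M xs} → 2 ^ a ≤ M → All (M <_) xs → cnt a xs ≡ 0
cnt-above a 2^a≤M big = cong length (filter-none (λ x → T? (inRange a x))
                                      (All.map (λ M<x → inRange-above a (≤-<-trans 2^a≤M M<x)) big))

⌊2*m/2⌋≡m : ∀ m → ⌊ 2 * m /2⌋ ≡ m
⌊2*m/2⌋≡m m = trans (cong (λ x → ⌊ m + x /2⌋) (+-identityʳ m)) (sym (n≡⌊n+n/2⌋ m))

2*m≤n⇒m≤⌊n/2⌋ : ∀ {m n} → 2 * m ≤ n → m ≤ ⌊ n /2⌋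
2*m≤n⇒m≤⌊n/2⌋ {m} 2m≤n = ≤-trans (≤-reflexive (sym (⌊2*m/2⌋≡m m))) (⌊n/2⌋-mono 2m≤n)

cnt-sparse : ∀ {M} b S B → All (M <_) B → 2 * (length S + length B) ≤ M → length S ≤ ⌊ 2 ^ b /2⌋ →
             cnt b S + cnt b B ≤ ⌊ 2 ^ b /2⌋
cnt-sparse {M} b S B big room S-small with 2 ^ b ≤? M
... | yes 2^b≤M = begin
  cnt b S + cnt b B   ≡⟨ cong (cnt b S +_) (cnt-above b 2^b≤M big) ⟩
  cnt b S + 0         ≡⟨ +-identityʳ (cnt b S) ⟩
  cnt b S             ≤⟨ cnt-≤ b S ⟩
  length S            ≤⟨ S-small ⟩
  ⌊ 2 ^ b /2⌋          ∎
  where open ≤-Reasoning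
... | no 2^b≰M = 2*m≤n⇒m≤⌊n/2⌋ (begin
  2 * (cnt b S + cnt b B)         ≤⟨ *-monoʳ-≤ 2 (+-mono-≤ (cnt-≤ b S) (cnt-≤ b B)) ⟩
  2 * (length S + length B)       ≤⟨ room ⟩
  M                               ≤⟨ <⇒≤ (≰⇒> 2^b≰M) ⟩
  2 ^ b                           ∎)
  where open ≤-Reasoning

dense-false : ∀ b K → cnt b K ≤ ⌊ 2 ^ b /2⌋ → dense b K ≡ false
dense-false b K few = ¬T⇒≡false (λ many → <⇒≱ (<ᵇ⇒< _ _ many) few)

dense-true : ∀ b K → ⌊ 2 ^ b /2⌋ < cnt b K → dense b K ≡ true
dense-true b K many = Equivalence.to T-≡ (<⇒<ᵇ many)

largestDense-just : ∀ N K e → e ≤ N → dense e K ≡ true → (∀ b → e < b → dense b K ≡ false) →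
                    largestDense N K ≡ just e
largestDense-just zero    K zero z≤n dense-e _ rewrite dense-e = refl
largestDense-just (suc N) K e e≤1+N dense-e sparse-above with m≤n⇒m<n∨m≡n e≤1+N
... | inj₂ refl rewrite dense-e = refl
... | inj₁ (s≤s e≤N) rewrite sparse-above (suc N) (s≤s e≤N) = largestDense-just N K e e≤N dense-e sparse-above

largestDense-nothing : ∀ N K → (∀ b → dense b K ≡ false) → largestDense N K ≡ nothing
largestDense-nothing zero    K sparse rewrite sparse zero    = refl
largestDense-nothing (suc N) K sparse rewrite sparse (suc N) = largestDense-nothing N K sparse

length-∷ʳ : ∀ {A : Set} (xs : List A) x → length (xs ++ [ x ]) ≡ suc (length xs)
length-∷ʳ xs x = length-++-comm xs [ x ]

n<2^n : ∀ n → n < 2 ^ n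
n<2^n zero    = s≤s z≤n
n<2^n (suc n) = begin-strict
  suc n              <⟨ s≤s (n<2^n n) ⟩
  1 + 2 ^ n          ≤⟨ +-monoˡ-≤ (2 ^ n) (m^n>0 2 n) ⟩
  2 ^ n + 2 ^ n      ≡⟨ cong (2 ^ n +_) (+-identityʳ (2 ^ n)) ⟨
  2 ^ suc n          ∎
  where open ≤-Reasoning

range : ℕ → ℕ → List ℕ
range s zero    = []
range s (suc l) = s ∷ range (suc s) l

range-++ : ∀ s a b → range s (a + b) ≡ range s a ++ range (s + a) b
range-++ s zero    b = cong (λ s′ → range s′ b) (sym (+-identityʳ s))
range-++ s (suc a) b =
  cong (s ∷_) (trans (range-++ (suc s) a b) (cong (λ s′ → range (suc s) a ++ range s′ b) (sym (+-suc s a))))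

module Adversary (h : Hash) (j M : ℕ) (room : 2 * (2 ^ j + 2 ^ j) ≤ M) where

  Big : ℕ → Set
  Big = M <_

  2^j≤M : 2 ^ j ≤ M
  2^j≤M = ≤-trans (m≤m+n (2 ^ j) (2 ^ j)) (≤-trans (m≤m+n _ _) room)

  data Filling : ℕ → Maybe HashPart → Set where
    empty : Filling 0 nothing
    part  : ∀ {n H} → exp H ≤ j → Stores Big n H → Filling n (just H)

  Filling-keys : ∀ {n hp} → Filling n hp → length (hashKeys? hp) ≡ n × All Big (hashKeys? hp)
  Filling-keys empty        = refl , []
  Filling-keys (part _ st)  = count st , keys st

  hashOnly : Maybe HashPart → Table
  hashOnly = mkTable nothing []

  buildHash-filling : ∀ K → 0 < length K → length K ≤ 2 ^ j → All Big K →
                      ∃[ H ] buildHash h K ≡ just H × Filling (length K) (just H)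
  buildHash-filling K nonempty |K|≤2^j big-K =
    let H , built , exp≡ , st = buildHash-stores h K nonempty big-K
    in  H , built , part (≤-trans (≤-reflexive exp≡) exp≤j) st
    where
    exp≤j : ⌈log₂ length K ⌉ ≤ j
    exp≤j = ≤-trans (⌈log₂⌉-mono-≤ |K|≤2^j) (≤-reflexive (⌈log₂2^n⌉≡n j))

  rehash-sparse : ∀ hp k → let K = hashKeys? hp ++ [ k ] in All Big K → length K ≤ 2 ^ j →
                  proj₁ (rehash h (hashOnly hp) k) ≡ hashOnly (buildHash h K)
  rehash-sparse hp k big-K |K|≤2^j = begin
    proj₁ (rehash h (hashOnly hp) k)
      ≡⟨ cong proj₁ (rehash-≡ h (hashOnly hp) k (largestDense-nothing (length K) K sparse)) ⟩
    mkTable nothing (filter (λ _ → T? false) K) (buildHash h (filter (λ _ → T? true) K))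
      ≡⟨ cong₂ (λ A B → mkTable nothing A (buildHash h B))
               (filter-none (λ _ → T? false) (All.universal (λ _ ()) K))
               (filter-all (λ _ → T? true) (All.universal _ K)) ⟩
    hashOnly (buildHash h K) ∎
    where
    open ≡-Reasoning
    K = hashKeys? hp ++ [ k ]
    sparse : ∀ b → dense b K ≡ false
    sparse b = dense-false b K (cnt-sparse b [] K big-K
                 (≤-trans (*-monoʳ-≤ 2 (≤-trans |K|≤2^j (m≤m+n _ _))) room) z≤n)

  rehash-filling : ∀ {n hp} k → Filling n hp → Big k → suc n ≤ 2 ^ j →
                   ∃[ H ] proj₁ (rehash h (hashOnly hp) k) ≡ hashOnly (just H) × Filling (suc n) (just H)
  rehash-filling {n} {hp} k filling big-k 1+n≤2^j =
    let H , built , filling′ = buildHash-filling K (≤-trans (s≤s z≤n) (≤-reflexive (sym |K|≡1+n))) |K|≤2^j big-K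
    in  H , trans (rehash-sparse hp k big-K |K|≤2^j) (cong hashOnly built) , subst (λ c → Filling c (just H)) |K|≡1+n filling′
    where
    K = hashKeys? hp ++ [ k ]
    |K|≡1+n : length K ≡ suc n
    |K|≡1+n = trans (length-∷ʳ (hashKeys? hp) k) (cong suc (proj₁ (Filling-keys filling)))
    |K|≤2^j : length K ≤ 2 ^ j
    |K|≤2^j = ≤-trans (≤-reflexive |K|≡1+n) 1+n≤2^j
    big-K : All Big K
    big-K = ++⁺ (proj₂ (Filling-keys filling)) (big-k ∷ [])

  insertKey-filling : ∀ {n hp} k → Filling n hp → Big k → suc n ≤ 2 ^ j →
                      ∃[ H ] proj₁ (insertKey h (hashOnly hp) k) ≡ hashOnly (just H) × Filling (suc n) (just H)
  insertKey-filling k empty big-k fits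
    rewrite insertKey-rehash h nothing [] nothing k refl (λ ()) = rehash-filling k empty big-k fits
  insertKey-filling k (part {H = H} e≤j st) big-k fits with m≤n⇒m<n∨m≡n (Stores-≤ H st)
  ... | inj₁ n<cap =
    let H′ , inserted , exp≡ , st′ = hashInsert-stores h H k st n<cap big-k
    in  H′ , cong proj₁ (insertKey-hashInsert h nothing [] H H′ k refl inserted) , part (≤-trans (≤-reflexive exp≡) e≤j) st′
  ... | inj₂ n≡cap
    rewrite insertKey-rehash h nothing [] (just H) k refl
              (λ { refl → hashInsert-full h H k (subst (λ c → Stores Big c H) n≡cap st) })
    = rehash-filling k (part e≤j st) big-k fits

  after-filling : ∀ {n hp} ks → Filling n hp → All Big ks → n + length ks ≤ 2 ^ j →
                  ∃[ hp′ ] after h (hashOnly hp) ks ≡ hashOnly hp′ × Filling (n + length ks) hp′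
  after-filling {n} {hp} [] filling _ _ = hp , refl , subst (λ c → Filling c hp) (sym (+-identityʳ n)) filling
  after-filling {n} (k ∷ ks) filling (big-k ∷ big-ks) fits =
    let H , inserted , filling′ = insertKey-filling k filling big-k (≤-trans (s≤s (m≤m+n n (length ks))) fits′)
        hp′ , done , filling″  = after-filling ks filling′ big-ks fits′
    in  hp′ , trans (cong (λ t → after h t ks) inserted) done ,
        subst (λ c → Filling c hp′) (sym (+-suc n (length ks))) filling″
    where
    fits′ : suc n + length ks ≤ 2 ^ j
    fits′ = ≤-trans (≤-reflexive (sym (+-suc n (length ks)))) fits

  data Loaded (c : ℕ) : Table → Set where
    loaded : ∀ {ae ak H} → All (λ x → 1 ≤ x × x ≤ c) ak → length ak ≡ c →
             exp H ≡ j → Stores Big (2 ^ j) H → Loaded c (mkTable ae ak (just H))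

  Filling-full : ∀ {n hp} → Filling n hp → n ≡ 2 ^ j → Loaded 0 (hashOnly hp)
  Filling-full empty 0≡2^j = ⊥-elim (<⇒≢ (m^n>0 2 j) 0≡2^j)
  Filling-full {hp = just H} (part e≤j st) refl = loaded [] refl (≤-antisym e≤j j≤e) st
    where
    j≤e : j ≤ exp H
    j≤e = begin
      j                       ≡⟨ ⌊log₂[2^n]⌋≡n j ⟨
      ⌊log₂ 2 ^ j ⌋            ≤⟨ ⌊log₂⌋-mono-≤ (Stores-≤ H st) ⟩
      ⌊log₂ 2 ^ exp H ⌋        ≡⟨ ⌊log₂[2^n]⌋≡n (exp H) ⟩
      exp H                   ∎
      where open ≤-Reasoning

  build : ∀ ks → All Big ks → length ks ≡ 2 ^ j →
          Loaded 0 (after h emptyTable ks) × arrExp (after h emptyTable ks) ≡ nothing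
  build ks big-ks |ks| =
    let hp , done , filling = after-filling ks empty big-ks (≤-reflexive |ks|)
    in  subst (λ t → Loaded 0 t × arrExp t ≡ nothing) (sym done) (Filling-full filling |ks| , refl)

  newArrExp-overflow : ∀ {c e} ak hk → All (λ x → 1 ≤ x × x ≤ c) ak → length ak ≡ c → All Big hk → length hk ≡ 2 ^ j →
                       ⌊ 2 ^ e /2⌋ ≤ c → c < 2 ^ e → e ≤ j → newArrExp ((ak ++ hk) ++ [ suc c ]) ≡ just e
  newArrExp-overflow {c} {e} ak hk small |ak| big |hk| half≤c c<2^e e≤j =
    largestDense-just (length K) K e e≤|K| dense-e sparse-above
    where
    K = (ak ++ hk) ++ [ suc c ]
    S = ak ++ [ suc c ]
    2^e≤2^j : 2 ^ e ≤ 2 ^ j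
    2^e≤2^j = ^-monoʳ-≤ 2 e≤j
    |S|≤2^e : length S ≤ 2 ^ e
    |S|≤2^e = ≤-trans (≤-reflexive (trans (length-∷ʳ ak (suc c)) (cong suc |ak|))) c<2^e
    cnt-K : ∀ b → cnt b K ≡ cnt b S + cnt b hk
    cnt-K b = begin
      cnt b K                                   ≡⟨ cnt-++ b (ak ++ hk) [ suc c ] ⟩
      cnt b (ak ++ hk) + cnt b [ suc c ]        ≡⟨ cong (_+ cnt b [ suc c ]) (cnt-++ b ak hk) ⟩
      (cnt b ak + cnt b hk) + cnt b [ suc c ]   ≡⟨ xy∙z≈xz∙y (cnt b ak) (cnt b hk) (cnt b [ suc c ]) ⟩
      (cnt b ak + cnt b [ suc c ]) + cnt b hk   ≡⟨ cong (_+ cnt b hk) (cnt-++ b ak [ suc c ]) ⟨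
      cnt b S + cnt b hk                        ∎
      where open ≡-Reasoning
    S-inside : All (λ x → T (inRange e x)) S
    S-inside = ++⁺ (All.map (λ (1≤x , x≤c) → inRange-intro e 1≤x (≤-trans x≤c (<⇒≤ c<2^e))) small)
                   (inRange-intro e (s≤s z≤n) c<2^e ∷ [])
    dense-e : dense e K ≡ true
    dense-e = dense-true e K (begin-strict
      ⌊ 2 ^ e /2⌋           ≤⟨ half≤c ⟩
      c                     <⟨ n<1+n c ⟩
      suc c                 ≡⟨ trans (length-∷ʳ ak (suc c)) (cong suc |ak|) ⟨
      length S              ≡⟨ cnt-all e S-inside ⟨
      cnt e S               ≡⟨ +-identityʳ (cnt e S) ⟨
      cnt e S + 0           ≡⟨ cong (cnt e S +_) (cnt-above e (≤-trans 2^e≤2^j 2^j≤M) big) ⟨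
      cnt e S + cnt e hk    ≡⟨ cnt-K e ⟨
      cnt e K               ∎)
      where open ≤-Reasoning
    sparse-above : ∀ b → e < b → dense b K ≡ false
    sparse-above (suc b) (s≤s e≤b) =
      dense-false (suc b) K (≤-trans (≤-reflexive (cnt-K (suc b))) (cnt-sparse (suc b) S hk big room′ S-small))
      where
      room′ : 2 * (length S + length hk) ≤ M
      room′ = ≤-trans (*-monoʳ-≤ 2 (+-mono-≤ (≤-trans |S|≤2^e 2^e≤2^j) (≤-reflexive |hk|))) room
      S-small : length S ≤ ⌊ 2 ^ suc b /2⌋
      S-small = ≤-trans |S|≤2^e (≤-trans (^-monoʳ-≤ 2 e≤b) (≤-reflexive (sym (⌊2*m/2⌋≡m (2 ^ b)))))
    e≤|K| : e ≤ length K
    e≤|K| = begin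
      e                    ≤⟨ e≤j ⟩
      j                    ≤⟨ <⇒≤ (n<2^n j) ⟩
      2 ^ j                ≡⟨ |hk| ⟨
      length hk            ≤⟨ length-++-≤ʳ hk {ak} ⟩
      length (ak ++ hk)    ≤⟨ length-++-≤ˡ (ak ++ hk) ⟩
      length K             ∎
      where open ≤-Reasoning

  insertKey-overflow : ∀ {c e t} → Loaded c t → inArr (arrExp t) (suc c) ≡ false →
                       ⌊ 2 ^ e /2⌋ ≤ c → c < 2 ^ e → e ≤ j →
                       let t′ , d = insertKey h t (suc c) in
                       Loaded (suc c) t′ × arrExp t′ ≡ just e × d ≡ suc (2 ^ j)
  insertKey-overflow {c} {e} (loaded {ae} {ak} {H} small |ak| exp≡ full) outside half≤c c<2^e e≤j =
    let H′ , built , exp≡′ , st′ = buildHash-stores h hk 0<|hk| (keys full)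
    in  subst (λ (t′ , d) → Loaded (suc c) t′ × arrExp t′ ≡ just e × d ≡ suc (2 ^ j))
              (sym (result≡ H′ built))
              ( loaded (++⁺ (All.map (λ (1≤x , x≤c) → 1≤x , m≤n⇒m≤1+n x≤c) small) ((s≤s z≤n , ≤-refl) ∷ []))
                       (trans (length-∷ʳ ak k) (cong suc |ak|))
                       (trans exp≡′ (trans (cong ⌈log₂_⌉ |hk|) (⌈log₂2^n⌉≡n j)))
                       (subst (λ n → Stores Big n H′) |hk| st′)
              , refl , refl )
    where
    t  = mkTable ae ak (just H)
    hk = hashKeys H
    k  = suc c
    |hk| : length hk ≡ 2 ^ j
    |hk| = count full
    0<|hk| : 0 < length hk
    0<|hk| = ≤-trans (m^n>0 2 j) (≤-reflexive (sym |hk|))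
    ak-inside : All (λ x → T (inRange e x)) ak
    ak-inside = All.map (λ (1≤x , x≤c) → inRange-intro e 1≤x (≤-trans x≤c (<⇒≤ c<2^e))) small
    hk-outside : All (λ x → ¬ T (inRange e x)) hk
    hk-outside = All.map (λ M<x → inRange-above e (≤-<-trans (≤-trans (^-monoʳ-≤ 2 e≤j) 2^j≤M) M<x)) (keys full)
    k-inside : T (inRange e k)
    k-inside = inRange-intro e (s≤s z≤n) c<2^e
    arr≡ : filter (λ x → T? (inRange e x)) ((ak ++ hk) ++ [ k ]) ≡ ak ++ [ k ]
    arr≡ = trans (filter-++ (λ x → T? (inRange e x)) (ak ++ hk) [ k ])
                 (cong₂ _++_ (filter-inside (inRange e) ak-inside hk-outside)
                             (filter-all (λ x → T? (inRange e x)) (k-inside ∷ [])))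
    moved≡ : filter (λ x → T? (not (inRange e x))) (ak ++ hk) ≡ hk
    moved≡ = filter-outside (inRange e) ak-inside hk-outside
    hash≡ : filter (λ x → T? (not (inRange e x))) ((ak ++ hk) ++ [ k ]) ≡ hk
    hash≡ = trans (filter-++ (λ x → T? (not (inRange e x))) (ak ++ hk) [ k ])
                  (trans (cong₂ _++_ moved≡ (filter-none (λ x → T? (not (inRange e x))) {[ k ]} (T⇒¬T-not {inRange e k} k-inside ∷ [])))
                         (++-identityʳ hk))
    result≡ : ∀ H′ → buildHash h hk ≡ just H′ →
              insertKey h t k ≡ (mkTable (just e) (ak ++ [ k ]) (just H′) , suc (2 ^ j))
    result≡ H′ built = begin
      insertKey h t k
        ≡⟨ insertKey-rehash h ae ak (just H) k outside
             (λ { refl → hashInsert-full h H k (subst (λ e → Stores Big (2 ^ e) H) (sym exp≡) full) }) ⟩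
      (proj₁ (rehash h t k) , suc (proj₂ (rehash h t k)))
        ≡⟨ cong (λ (t′ , d) → t′ , suc d)
                (rehash-≡ h t k (newArrExp-overflow ak hk small |ak| (keys full) |hk| half≤c c<2^e e≤j)) ⟩
      ( mkTable (just e) (filter (λ x → T? (inRange e x)) ((ak ++ hk) ++ [ k ]))
                         (buildHash h (filter (λ x → T? (not (inRange e x))) ((ak ++ hk) ++ [ k ])))
      , suc (length (filter (λ x → T? (not (inRange e x))) (ak ++ hk))) )
        ≡⟨ cong₂ (λ A (B , C) → mkTable (just e) A (buildHash h B) , suc (length C)) arr≡ (cong₂ _,_ hash≡ moved≡) ⟩
      (mkTable (just e) (ak ++ [ k ]) (buildHash h hk) , suc (length hk))
        ≡⟨ cong₂ (λ B C → mkTable (just e) (ak ++ [ k ]) B , suc C) built |hk| ⟩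
      (mkTable (just e) (ak ++ [ k ]) (just H′) , suc (2 ^ j)) ∎
      where open ≡-Reasoning

  Loaded-push : ∀ {c ae ak hp} → Loaded c (mkTable ae ak hp) → Loaded (suc c) (mkTable ae (suc c ∷ ak) hp)
  Loaded-push (loaded small |ak| exp≡ full) =
    loaded ((s≤s z≤n , ≤-refl) ∷ All.map (λ (1≤x , x≤c) → 1≤x , m≤n⇒m≤1+n x≤c) small) (cong suc |ak|) exp≡ full

  after-array : ∀ {c e t} l → Loaded c t → arrExp t ≡ just e → c + l ≤ 2 ^ e →
                let t′ = after h t (range (suc c) l) in Loaded (c + l) t′ × arrExp t′ ≡ just e
  after-array {c} zero ld ae≡ _ = subst (λ n → Loaded n _) (sym (+-identityʳ c)) ld , ae≡
  after-array {c} {e} {mkTable ae ak hp} (suc l) ld refl fits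
    with fits′ ← ≤-trans (≤-reflexive (sym (+-suc c l))) fits
    rewrite insertKey-inArr h (just e) ak hp (suc c) (Equivalence.to T-≡ (inRange-intro e (s≤s z≤n) (m+n≤o⇒m≤o (suc c) fits′)))
    = let ld′ , ae′ = after-array l (Loaded-push ld) refl fits′
      in  subst (λ n → Loaded n (after h (mkTable (just e) (suc c ∷ ak) hp) (range (2 + c) l))) (sym (+-suc c l)) ld′ , ae′

  doubling : ∀ {c e t} l → Loaded c t → inArr (arrExp t) (suc c) ≡ false →
             ⌊ 2 ^ e /2⌋ ≤ c → c + suc l ≡ 2 ^ e → e ≤ j →
             let ks = range (suc c) (suc l) in
             Loaded (2 ^ e) (after h t ks) × arrExp (after h t ks) ≡ just e × suc (2 ^ j) ≤ calls h t ks
  doubling {c} {e} {t} l ld outside half≤c filled e≤j =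
    let ld₁ , ae₁ , cost = insertKey-overflow ld outside half≤c c<2^e e≤j
        ld₂ , ae₂        = after-array l ld₁ ae₁ (≤-reflexive filled′)
    in  subst (λ n → Loaded n _) filled′ ld₂ , ae₂ , ≤-trans (≤-reflexive (sym cost)) (m≤m+n _ _)
    where
    filled′ : suc c + l ≡ 2 ^ e
    filled′ = trans (sym (+-suc c l)) filled
    c<2^e : c < 2 ^ e
    c<2^e = ≤-trans (s≤s (m≤m+n c l)) (≤-reflexive filled′)

  Phase : ℕ → Table → List ℕ → Set
  Phase A t ks = Loaded (2 ^ A) (after h t ks) × arrExp (after h t ks) ≡ just A × suc A * suc (2 ^ j) ≤ calls h t ks

  phases : ∀ {t} A → Loaded 0 t → arrExp t ≡ nothing → A ≤ j → Phase A t (range 1 (2 ^ A))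
  phases zero ld ae≡ _ =
    let ld₁ , ae₁ , cost = doubling 0 ld (cong (λ a → inArr a 1) ae≡) z≤n refl z≤n
    in  ld₁ , ae₁ , ≤-trans (≤-reflexive (+-identityʳ _)) cost
  phases {t} (suc A) ld ae≡ 1+A≤j = subst (Phase (suc A) t) (sym split) phase
    where
    l = pred (2 ^ A)
    2^A≡1+l : 2 ^ A ≡ suc l
    2^A≡1+l = sym (suc-pred (2 ^ A) {{m^n≢0 2 A}})
    xs = range 1 (2 ^ A)
    ys = range (suc (2 ^ A)) (suc l)
    split : range 1 (2 ^ suc A) ≡ xs ++ ys
    split = begin
      range 1 (2 ^ suc A)         ≡⟨ cong (range 1) (trans (cong (2 ^ A +_) (+-identityʳ (2 ^ A))) (cong (2 ^ A +_) 2^A≡1+l)) ⟩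
      range 1 (2 ^ A + suc l)     ≡⟨ range-++ 1 (2 ^ A) (suc l) ⟩
      xs ++ ys                    ∎
      where open ≡-Reasoning
    previous = phases A ld ae≡ (≤-trans (n≤1+n A) 1+A≤j)
    t₁ = after h t xs
    current : Loaded (2 ^ suc A) (after h t₁ ys) × arrExp (after h t₁ ys) ≡ just (suc A) × suc (2 ^ j) ≤ calls h t₁ ys
    current = doubling l (proj₁ previous) outside (≤-reflexive (⌊2*m/2⌋≡m (2 ^ A))) filled 1+A≤j
      where
      outside : inArr (arrExp t₁) (suc (2 ^ A)) ≡ false
      outside rewrite proj₁ (proj₂ previous) = ¬T⇒≡false (inRange-above A ≤-refl)
      filled : 2 ^ A + suc l ≡ 2 ^ suc A
      filled = trans (cong (2 ^ A +_) (sym 2^A≡1+l)) (cong (2 ^ A +_) (sym (+-identityʳ (2 ^ A))))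
    phase : Phase (suc A) t (xs ++ ys)
    phase rewrite after-++ h t xs ys | calls-++ h t xs ys =
      proj₁ current , proj₁ (proj₂ current) , (begin
        suc (suc A) * suc (2 ^ j)                  ≡⟨ +-comm (suc (2 ^ j)) (suc A * suc (2 ^ j)) ⟩
        suc A * suc (2 ^ j) + suc (2 ^ j)          ≤⟨ +-mono-≤ (proj₂ (proj₂ previous)) (proj₂ (proj₂ current)) ⟩
        calls h t xs + calls h t₁ ys               ∎)
      where open ≤-Reasoning

  adversarial-cost : ∀ bigs rest → All Big bigs → length bigs ≡ 2 ^ j →
                     suc j * suc (2 ^ j) ≤ calls h emptyTable (bigs ++ range 1 (2 ^ j) ++ rest)
  adversarial-cost bigs rest big-bigs |bigs| = begin
    suc j * suc (2 ^ j)                                   ≤⟨ proj₂ (proj₂ phase) ⟩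
    calls h t₀ (range 1 (2 ^ j))                          ≤⟨ m≤m+n _ _ ⟩
    calls h t₀ (range 1 (2 ^ j)) + calls h t₁ rest        ≡⟨ calls-++ h t₀ (range 1 (2 ^ j)) rest ⟨
    calls h t₀ (range 1 (2 ^ j) ++ rest)                  ≤⟨ m≤n+m _ _ ⟩
    calls h emptyTable bigs + calls h t₀ (range 1 (2 ^ j) ++ rest) ≡⟨ calls-++ h emptyTable bigs _ ⟨
    calls h emptyTable (bigs ++ range 1 (2 ^ j) ++ rest)  ∎
    where
    open ≤-Reasoning
    t₀ = after h emptyTable bigs
    t₁ = after h t₀ (range 1 (2 ^ j))
    phase = phases j (proj₁ (build bigs big-bigs |bigs|)) (proj₂ (build bigs big-bigs |bigs|)) ≤-refl

⌊n/2⌋+⌊n/2⌋≤n : ∀ n → ⌊ n /2⌋ + ⌊ n /2⌋ ≤ n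
⌊n/2⌋+⌊n/2⌋≤n n = ≤-trans (+-monoʳ-≤ ⌊ n /2⌋ (⌊n/2⌋≤⌈n/2⌉ n)) (≤-reflexive (⌊n/2⌋+⌈n/2⌉≡n n))

2^⌊log2⌋n≤n : ∀ n acc → 2 ^ ⌊log2⌋ (suc n) acc ≤ suc n
2^⌊log2⌋n≤n zero    _            = ≤-refl
2^⌊log2⌋n≤n (suc n) (IWF.acc rs) = begin
  2 * 2 ^ ⌊log2⌋ (suc ⌊ n /2⌋) _    ≤⟨ *-monoʳ-≤ 2 (2^⌊log2⌋n≤n ⌊ n /2⌋ _) ⟩
  2 * suc ⌊ n /2⌋                   ≡⟨ cong (suc ⌊ n /2⌋ +_) (+-identityʳ (suc ⌊ n /2⌋)) ⟩
  suc ⌊ n /2⌋ + suc ⌊ n /2⌋         ≡⟨ cong suc (+-suc ⌊ n /2⌋ ⌊ n /2⌋) ⟩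
  2 + (⌊ n /2⌋ + ⌊ n /2⌋)           ≤⟨ s≤s (s≤s (⌊n/2⌋+⌊n/2⌋≤n n)) ⟩
  2 + n                            ∎
  where open ≤-Reasoning

2^⌊log₂n⌋≤n : ∀ n → 0 < n → 2 ^ ⌊log₂ n ⌋ ≤ n
2^⌊log₂n⌋≤n (suc n) _ = 2^⌊log2⌋n≤n n _

n<2^[1+⌊log₂n⌋] : ∀ n → n < 2 ^ suc ⌊log₂ n ⌋
n<2^[1+⌊log₂n⌋] n = ≰⇒> λ 2^[1+k]≤n → 1+n≰n (begin
  suc ⌊log₂ n ⌋                 ≡⟨ ⌊log₂[2^n]⌋≡n (suc ⌊log₂ n ⌋) ⟨
  ⌊log₂ 2 ^ suc ⌊log₂ n ⌋ ⌋      ≤⟨ ⌊log₂⌋-mono-≤ 2^[1+k]≤n ⟩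
  ⌊log₂ n ⌋                     ∎)
  where open ≤-Reasoning

length-range : ∀ s l → length (range s l) ≡ l
length-range s zero    = refl
length-range s (suc l) = cong suc (length-range (suc s) l)

range-≥ : ∀ s l → All (s ≤_) (range s l)
range-≥ s zero    = []
range-≥ s (suc l) = ≤-refl ∷ All.map (≤-trans (n≤1+n s)) (range-≥ (suc s) l)

map-suc-applyUpTo : ∀ f s n → (∀ i → f i ≡ s + i) → map suc (applyUpTo f n) ≡ range (suc s) n
map-suc-applyUpTo f s zero    _  = refl
map-suc-applyUpTo f s (suc n) f≗ =
  cong₂ _∷_ (cong suc (trans (f≗ 0) (+-identityʳ s)))
            (map-suc-applyUpTo (λ i → f (suc i)) (suc s) n (λ i → trans (f≗ (suc i)) (+-suc s i)))

map-suc-upTo : ∀ n → map suc (upTo n) ≡ range 1 n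
map-suc-upTo n = map-suc-applyUpTo (λ i → i) 0 n (λ _ → refl)

adversary-↭ : ∀ P M → P ≤ M → range (suc M) P ++ range 1 P ++ range (suc P) (M ∸ P) ↭ range 1 (M + P)
adversary-↭ P M P≤M = ↭-trans (++-comm (range (suc M) P) (range 1 P ++ range (suc P) (M ∸ P))) (↭-reflexive (sym split))
  where
  open ≡-Reasoning
  split : range 1 (M + P) ≡ (range 1 P ++ range (suc P) (M ∸ P)) ++ range (suc M) P
  split = begin
    range 1 (M + P)                                           ≡⟨ cong (λ m → range 1 (m + P)) (m+[n∸m]≡n P≤M) ⟨
    range 1 (P + (M ∸ P) + P)                                 ≡⟨ range-++ 1 (P + (M ∸ P)) P ⟩
    range 1 (P + (M ∸ P)) ++ range (suc (P + (M ∸ P))) P      ≡⟨ cong₂ (λ xs m → xs ++ range (suc m) P) (range-++ 1 P (M ∸ P)) (m+[n∸m]≡n P≤M) ⟩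
    (range 1 P ++ range (suc P) (M ∸ P)) ++ range (suc M) P   ∎

16P[3+3j]≡48[1+j]P : ∀ P j → 16 * P * (3 * suc j) ≡ 48 * (suc j * P)
16P[3+3j]≡48[1+j]P = solve-∀

log₂-scale : ∀ n → 8 ≤ n → let j = ⌊log₂ n ⌋ ∸ 3 in
             8 * 2 ^ j ≤ n × n * ⌊log₂ n ⌋ ≤ 48 * (suc j * suc (2 ^ j))
log₂-scale n 8≤n = 8P≤n , (begin
  n * k                   ≤⟨ *-monoˡ-≤ k (<⇒≤ n<16P) ⟩
  16 * P * k              ≡⟨ cong (16 * P *_) k≡3+j ⟩
  16 * P * (3 + j)        ≤⟨ *-monoʳ-≤ (16 * P) (≤-trans (+-monoʳ-≤ 3 (m≤n*m j 3)) (≤-reflexive (sym (*-suc 3 j)))) ⟩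
  16 * P * (3 * suc j)    ≡⟨ 16P[3+3j]≡48[1+j]P P j ⟩
  48 * (suc j * P)        ≤⟨ *-monoʳ-≤ 48 (*-monoʳ-≤ (suc j) (n≤1+n P)) ⟩
  48 * (suc j * suc P)    ∎)
  where
  open ≤-Reasoning
  k = ⌊log₂ n ⌋
  j = k ∸ 3
  P = 2 ^ j
  k≡3+j : k ≡ 3 + j
  k≡3+j = sym (m+[n∸m]≡n (⌊log₂⌋-mono-≤ 8≤n))
  8P≤n : 8 * P ≤ n
  8P≤n = subst (_≤ n) (trans (cong (2 ^_) k≡3+j) (^-distribˡ-+-* 2 3 j)) (2^⌊log₂n⌋≤n n (≤-trans (s≤s z≤n) 8≤n))
  n<16P : n < 16 * P
  n<16P = subst (n <_) (trans (cong (λ x → 2 ^ suc x) k≡3+j) (^-distribˡ-+-* 2 4 j)) (n<2^[1+⌊log₂n⌋] n)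

2[P+P]+P≡5P : ∀ P → 2 * (P + P) + P ≡ 5 * P
2[P+P]+P≡5P = solve-∀

8P≤n⇒2[P+P]≤n∸P : ∀ P n → 8 * P ≤ n → 2 * (P + P) ≤ n ∸ P
8P≤n⇒2[P+P]≤n∸P P n 8P≤n =
  m+n≤o⇒m≤o∸n (2 * (P + P)) (≤-trans (≤-reflexive (2[P+P]+P≡5P P)) (≤-trans (*-monoˡ-≤ P (m≤m+n 5 3)) 8P≤n))

proposition3 : ∃[ C ] ∃[ N₀ ] ((h : Hash) (n : ℕ) → N₀ ≤ n →
                 ∃[ π ] ((π ↭ map suc (upTo n)) × (n * ⌊log₂ n ⌋ ≤ C * luaCalls h π)))
proposition3 = 48 , 8 , worst-case
  where
  worst-case : (h : Hash) (n : ℕ) → 8 ≤ n →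
               ∃[ π ] ((π ↭ map suc (upTo n)) × (n * ⌊log₂ n ⌋ ≤ 48 * luaCalls h π))
  worst-case h n 8≤n = bigs ++ smalls , π↭ , (begin
    n * ⌊log₂ n ⌋                            ≤⟨ proj₂ (log₂-scale n 8≤n) ⟩
    48 * (suc j * suc P)                     ≤⟨ *-monoʳ-≤ 48 (adversarial-cost bigs mid (range-≥ (suc M) P) (length-range (suc M) P)) ⟩
    48 * calls h emptyTable (bigs ++ smalls) ≡⟨ cong (48 *_) (luaCalls≡calls h (bigs ++ smalls)) ⟨
    48 * luaCalls h (bigs ++ smalls)         ∎)
    where
    open ≤-Reasoning
    j = ⌊log₂ n ⌋ ∸ 3
    P = 2 ^ j
    M = n ∸ P
    room : 2 * (P + P) ≤ M
    room = 8P≤n⇒2[P+P]≤n∸P P n (proj₁ (log₂-scale n 8≤n))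
    open Adversary h j M room using (adversarial-cost)
    P≤M : P ≤ M
    P≤M = ≤-trans (m≤m+n P P) (≤-trans (m≤n*m (P + P) 2) room)
    bigs   = range (suc M) P
    mid    = range (suc P) (M ∸ P)
    smalls = range 1 P ++ mid
    n≡M+P : n ≡ M + P
    n≡M+P = sym (m∸n+n≡m (≤-trans P≤M (m∸n≤m n P)))
    π↭ : bigs ++ smalls ↭ map suc (upTo n)
    π↭ = subst (bigs ++ smalls ↭_) (sym (trans (map-suc-upTo n) (cong (range 1) n≡M+P))) (adversary-↭ P M P≤M)
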